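{- For $n\ge0$, \[\sum_{\alpha\in\mathrm{UFR}_n}q^{\mathrm{lucky}(\alpha)}=\frac{n!}{2^{n+1}\sqrt{q(q+2)}}\Bigl(\bigl(q+\sqrt{q(q+2)}\bigr)^{n+1}-\bigl(q-\sqrt{q(q+2)}\bigr)^{n+1}\Bigr).\]
   Context: $\mathrm{UFR}_n$ is the set of unit Fubini rankings with $n$ competitors: tuples $\alpha=(a_1,\ldots,a_n)\in\{1,\ldots,n\}^n$ with $a_i=1+|\{j:a_j<a_i\}|$ for every $i$ and in which each value appears at most twice ($\mathrm{UFR}_0$ consists of the empty ranking). $\mathrm{lucky}(\alpha)$ is the number of lucky cars: cars $1,\ldots,n$ enter in order a one-way street with spots $1,\ldots,n$, car $i$ parks at spot $a_i$ if free, else at the first free spot after $a_i$, and is lucky if it parks at $a_i$. The right-hand side is a polynomial in $q$ (the square roots cancel). -}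

module Defs where

open import Data.Nat as ℕ using (ℕ; zero; suc; _<ᵇ_; _≡ᵇ_; _≤ᵇ_; _!)
open import Data.Bool using (Bool; true; false; if_then_else_; _∧_)
open import Data.Maybe using (Maybe; just; nothing)
open import Data.List using (List; []; _∷_; [_]; map; concatMap; upTo; filterᵇ; length; foldr)
open import Data.Bool.ListAction using (all; any)
open import Data.Vec using (Vec; toList) renaming ([] to []ᵛ; _∷_ to _∷ᵛ_)
open import Data.Integer as ℤ using (ℤ; +_)
open import Data.Product using (_×_; _,_; proj₁; proj₂)

tuples : (n k : ℕ) → List (Vec ℕ k)
tuples n zero    = [ []ᵛ ]
tuples n (suc k) = concatMap (λ a → map (a ∷ᵛ_) (tuples n k)) (map suc (upTo n))

count : (ℕ → Bool) → List ℕ → ℕ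
count p as = length (filterᵇ p as)

isFubini : List ℕ → Bool
isFubini as = all (λ a → a ≡ᵇ suc (count (λ b → b <ᵇ a) as)) as

isUnit : List ℕ → Bool
isUnit as = all (λ a → count (λ b → b ≡ᵇ a) as ≤ᵇ 2) as

-- UFRₙ as an explicit (duplicate-free) list of its elements
UFR : (n : ℕ) → List (Vec ℕ n)
UFR n = filterᵇ (λ v → isFubini (toList v) ∧ isUnit (toList v)) (tuples n n)

_∈ᵇ_ : ℕ → List ℕ → Bool
s ∈ᵇ occ = any (λ t → t ≡ᵇ s) occ

firstFree : (n fuel : ℕ) → List ℕ → ℕ → Maybe ℕ
firstFree n zero       occ s = nothing
firstFree n (suc fuel) occ s =
  if s ≤ᵇ n then (if s ∈ᵇ occ then firstFree n fuel occ (suc s) else just s) else nothing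

parkLucky : (n : ℕ) → List ℕ → List ℕ → ℕ
parkLucky n occ [] = 0
parkLucky n occ (a ∷ as) with firstFree n (suc n) occ a
... | nothing = parkLucky n occ as
... | just s  = (if s ≡ᵇ a then 1 else 0) ℕ.+ parkLucky n (s ∷ occ) as

lucky : {n : ℕ} → Vec ℕ n → ℕ
lucky {n} α = parkLucky n [] (toList α)

luckyGF : ℤ → (n : ℕ) → ℤ
luckyGF q n = foldr (λ α acc → (q ℤ.^ lucky α) ℤ.+ acc) (+ 0) (UFR n)

-- The ring ℤ[√D] = ℤ[s]/(s² − D): a pair (x , y) stands for x + y·√D.

ℤ√ : Set
ℤ√ = ℤ × ℤ

module Quad (D : ℤ) where
  _⊕_ : ℤ√ → ℤ√ → ℤ√
  (a , b) ⊕ (c , d) = (a ℤ.+ c , b ℤ.+ d)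

  _⊖_ : ℤ√ → ℤ√ → ℤ√
  (a , b) ⊖ (c , d) = (a ℤ.- c , b ℤ.- d)

  _⊗_ : ℤ√ → ℤ√ → ℤ√
  (a , b) ⊗ (c , d) = (a ℤ.* c ℤ.+ D ℤ.* (b ℤ.* d) , a ℤ.* d ℤ.+ b ℤ.* c)

  _⊘_ : ℤ√ → ℕ → ℤ√
  x ⊘ zero  = (+ 1 , + 0)
  x ⊘ suc k = x ⊗ (x ⊘ k)

  ι : ℤ → ℤ√
  ι a = (a , + 0)

  √D : ℤ√
  √D = (+ 0 , + 1)

{-# OPTIONS --safe #-}
-- Record a ranking a ∈ {1,…,n}ⁿ by its profile (c_n, …, c_1), c_r = #{i : a_i = r}.  It is a
-- unit Fubini ranking iff every nonzero c_r is 1 or 2 with c_1 + ⋯ + c_{r-1} = r − 1, and then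
-- exactly the first car preferring each value is lucky: the second one finds r taken and parks
-- at r + 1, which is never a value.  So a ranking contributes q^(number of nonzero c_r).
-- Summing these weights over all words of length k over {1,…,m+1} and splitting off the
-- occurrences of the letter m+1 gives a binomial recurrence, which on the diagonal k = m becomes
-- a_{n+2} = (n+2) q a_{n+1} + C(n+2,2) q a_n with a_0 = 1, a_1 = q.  Writing
-- (q + √D)^k = P_k + β_k √D with D = q(q+2), one has (q + √D)² = 2q (q + √D) + 2q, hence
-- β_{k+2} = 2q (β_{k+1} + β_k), and induction gives 2ⁿ a_n = n! β_{n+1}; finally
-- (q + √D)^{n+1} − (q − √D)^{n+1} = 2 β_{n+1} √D.
module Submission where

open import Defs
open import Data.Nat using (ℕ; suc; _!; _^_)
open import Data.Integer using (ℤ; +_; _*_; _+_)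
open import Relation.Binary.PropositionalEquality using (_≡_)

open import Data.Bool using (Bool; true; false; if_then_else_; T; not; _∧_)
open import Data.Bool.Properties using (T-≡; T-∧; T-∨; ∧-zeroʳ; ¬-not)
open import Data.Empty using (⊥-elim)
open import Data.List using (List; []; _∷_; [_]; _++_; _∷ʳ_; map; concatMap; upTo; filterᵇ; foldr; length)
open import Data.List.Membership.Propositional using (_∈_)
open import Data.List.Properties using (map-++; upTo-∷ʳ)
open import Data.List.Relation.Unary.All as All using (All; []; _∷_)
open import Data.List.Relation.Unary.All.Properties using (all-upTo; map⁺; concat⁺; all⁺; all⁻)
open import Data.List.Relation.Unary.Any using (here; there)
open import Data.Nat as ℕ using (zero; _≤_; _<_; z≤n; s≤s; z<s; _≡ᵇ_; _<ᵇ_; _≤ᵇ_)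
open import Data.Nat.Combinatorics using (_C_; nC1≡n; nCk+nC[k+1]≡[n+1]C[k+1])
open import Data.Nat.ListAction using (sum)
import Data.Nat.Properties as ℕₚ
import Data.Nat.Tactic.RingSolver as ℕ-Solver
import Data.Integer as ℤ
import Data.Integer.Properties as ℤₚ
open import Data.Integer.Tactic.RingSolver using (solve-∀)
open import Data.Product using (_×_; _,_; proj₁; proj₂; ∃-syntax)
open import Data.Product.Function.NonDependent.Propositional using (_×-⇔_)
open import Data.Sum using (_⊎_; inj₁; inj₂; [_,_]′)
open import Data.Vec using (Vec; toList) renaming (_∷_ to _∷ᵛ_)
open import Data.Vec.Properties using (length-toList)
open import Function using (_∘_; _⇔_; mk⇔; Equivalence)
import Function.Properties.Equivalence as ⇔
open import Relation.Binary.PropositionalEquality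
  using (refl; sym; trans; cong; cong₂; subst; subst₂; _≢_; module ≡-Reasoning)
open import Relation.Nullary using (¬_)
open import Relation.Nullary.Decidable using (yes; no; dec-true; dec-false)
open import Algebra.Properties.CommutativeSemigroup ℤₚ.+-commutativeSemigroup using (interchange)
open import Algebra.Properties.CommutativeSemigroup ℤₚ.*-commutativeSemigroup using (x∙yz≈y∙xz)

open ≡-Reasoning

private variable
  A B : Set

sumBy : (A → ℤ) → List A → ℤ
sumBy f = foldr (λ x acc → f x + acc) (+ 0)

sumBy-congᴬ : {f g : A → ℤ} {xs : List A} → All (λ x → f x ≡ g x) xs → sumBy f xs ≡ sumBy g xs
sumBy-congᴬ []       = refl
sumBy-congᴬ (e ∷ es) = cong₂ _+_ e (sumBy-congᴬ es)

sumBy-cong : {f g : A → ℤ} (xs : List A) → (∀ x → f x ≡ g x) → sumBy f xs ≡ sumBy g xs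
sumBy-cong xs e = sumBy-congᴬ (All.universal e xs)

sumBy-++ : (f : A → ℤ) (xs ys : List A) → sumBy f (xs ++ ys) ≡ sumBy f xs + sumBy f ys
sumBy-++ f []       ys = sym (ℤₚ.+-identityˡ _)
sumBy-++ f (x ∷ xs) ys = trans (cong (_+_ (f x)) (sumBy-++ f xs ys)) (sym (ℤₚ.+-assoc (f x) _ _))

sumBy-∷ʳ : (f : A → ℤ) (xs : List A) (x : A) → sumBy f (xs ∷ʳ x) ≡ sumBy f xs + f x
sumBy-∷ʳ f xs x = trans (sumBy-++ f xs [ x ]) (cong (_+_ (sumBy f xs)) (ℤₚ.+-identityʳ (f x)))

sumBy-map : (f : B → ℤ) (g : A → B) (xs : List A) → sumBy f (map g xs) ≡ sumBy (f ∘ g) xs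
sumBy-map f g []       = refl
sumBy-map f g (x ∷ xs) = cong (_+_ (f (g x))) (sumBy-map f g xs)

sumBy-concatMap : (f : B → ℤ) (g : A → List B) (xs : List A) →
  sumBy f (concatMap g xs) ≡ sumBy (sumBy f ∘ g) xs
sumBy-concatMap f g []       = refl
sumBy-concatMap f g (x ∷ xs) =
  trans (sumBy-++ f (g x) (concatMap g xs)) (cong (_+_ (sumBy f (g x))) (sumBy-concatMap f g xs))

sumBy-*ˡ : (c : ℤ) (f : A → ℤ) (xs : List A) → sumBy (λ x → c * f x) xs ≡ c * sumBy f xs
sumBy-*ˡ c f []       = sym (ℤₚ.*-zeroʳ c)
sumBy-*ˡ c f (x ∷ xs) = trans (cong (_+_ (c * f x)) (sumBy-*ˡ c f xs)) (sym (ℤₚ.*-distribˡ-+ c (f x) _))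

sumBy-filterᵇ : (p : A → Bool) (f : A → ℤ) (xs : List A) →
  sumBy f (filterᵇ p xs) ≡ sumBy (λ x → if p x then f x else + 0) xs
sumBy-filterᵇ p f []       = refl
sumBy-filterᵇ p f (x ∷ xs) with p x
... | true  = cong (_+_ (f x)) (sumBy-filterᵇ p f xs)
... | false = trans (sumBy-filterᵇ p f xs) (sym (ℤₚ.+-identityˡ _))

-- binomialSum k R = Σ_{j+i=k} (k choose j) R j i.
binomialSum : ℕ → (ℕ → ℕ → ℤ) → ℤ
binomialSum zero    R = R 0 0
binomialSum (suc k) R = binomialSum k (λ j i → R j (suc i)) + binomialSum k (λ j i → R (suc j) i)

binomialSum-cong : ∀ k {R R′ : ℕ → ℕ → ℤ} → (∀ j i → R j i ≡ R′ j i) → binomialSum k R ≡ binomialSum k R′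
binomialSum-cong zero    e = e 0 0
binomialSum-cong (suc k) e =
  cong₂ _+_ (binomialSum-cong k (λ j i → e j (suc i))) (binomialSum-cong k (λ j i → e (suc j) i))

binomialSum-+ : ∀ k (R R′ : ℕ → ℕ → ℤ) →
  binomialSum k (λ j i → R j i + R′ j i) ≡ binomialSum k R + binomialSum k R′
binomialSum-+ zero    R R′ = refl
binomialSum-+ (suc k) R R′ = trans
  (cong₂ _+_ (binomialSum-+ k (λ j i → R j (suc i)) (λ j i → R′ j (suc i)))
             (binomialSum-+ k (λ j i → R (suc j) i) (λ j i → R′ (suc j) i)))
  (interchange (binomialSum k (λ j i → R j (suc i))) (binomialSum k (λ j i → R′ j (suc i)))
               (binomialSum k (λ j i → R (suc j) i)) (binomialSum k (λ j i → R′ (suc j) i)))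

binomialSum-zero : ∀ k → binomialSum k (λ _ _ → + 0) ≡ + 0
binomialSum-zero zero    = refl
binomialSum-zero (suc k) = cong₂ _+_ (binomialSum-zero k) (binomialSum-zero k)

sumBy-binomialSum : ∀ k (F : A → ℕ → ℕ → ℤ) (xs : List A) →
  sumBy (λ x → binomialSum k (F x)) xs ≡ binomialSum k (λ j i → sumBy (λ x → F x j i) xs)
sumBy-binomialSum k F []       = sym (binomialSum-zero k)
sumBy-binomialSum k F (x ∷ xs) =
  trans (cong (_+_ (binomialSum k (F x))) (sumBy-binomialSum k F xs)) (sym (binomialSum-+ k (F x) _))

binomialSum-support≤0 : ∀ k (R : ℕ → ℕ → ℤ) → (∀ j i → R (suc j) i ≡ + 0) → binomialSum k R ≡ R 0 k
binomialSum-support≤0 zero    R R≥1 = refl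
binomialSum-support≤0 (suc k) R R≥1 = begin
  binomialSum k (λ j i → R j (suc i)) + binomialSum k (λ j i → R (suc j) i)
    ≡⟨ cong₂ _+_ (binomialSum-support≤0 k (λ j i → R j (suc i)) (λ j i → R≥1 j (suc i)))
                 (trans (binomialSum-cong k R≥1) (binomialSum-zero k)) ⟩
  R 0 (suc k) + + 0
    ≡⟨ ℤₚ.+-identityʳ _ ⟩
  R 0 (suc k) ∎

binomialSum-support≤1 : ∀ k (R : ℕ → ℕ → ℤ) → (∀ j i → R (2 ℕ.+ j) i ≡ + 0) →
  binomialSum (suc k) R ≡ R 0 (suc k) + + suc k * R 1 k
binomialSum-support≤1 zero    R R≥2 = cong (_+_ (R 0 1)) (sym (ℤₚ.*-identityˡ (R 1 0)))
binomialSum-support≤1 (suc k) R R≥2 = begin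
  binomialSum (suc k) (λ j i → R j (suc i)) + binomialSum (suc k) (λ j i → R (suc j) i)
    ≡⟨ cong₂ _+_ (binomialSum-support≤1 k (λ j i → R j (suc i)) (λ j i → R≥2 j (suc i)))
                 (binomialSum-support≤0 (suc k) (λ j i → R (suc j) i) R≥2) ⟩
  (R 0 (2 ℕ.+ k) + + suc k * R 1 (suc k)) + R 1 (suc k)
    ≡⟨ absorb (R 0 (2 ℕ.+ k)) (R 1 (suc k)) (+ suc k) ⟩
  R 0 (2 ℕ.+ k) + + (2 ℕ.+ k) * R 1 (suc k) ∎
  where
  absorb : ∀ a b x → (a + x * b) + b ≡ a + (+ 1 + x) * b
  absorb = solve-∀

binomialSum-support≤2 : ∀ k (R : ℕ → ℕ → ℤ) → (∀ j i → R (3 ℕ.+ j) i ≡ + 0) →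
  binomialSum (2 ℕ.+ k) R ≡ R 0 (2 ℕ.+ k) + + (2 ℕ.+ k) * R 1 (suc k) + + ((2 ℕ.+ k) C 2) * R 2 k
binomialSum-support≤2 zero    R R≥3 = begin
  (R 0 2 + R 1 1) + binomialSum 1 (λ j i → R (suc j) i)
    ≡⟨ cong (_+_ (R 0 2 + R 1 1)) (binomialSum-support≤1 0 (λ j i → R (suc j) i) R≥3) ⟩
  (R 0 2 + R 1 1) + (R 1 1 + + 1 * R 2 0)
    ≡⟨ collect (R 0 2) (R 1 1) (R 2 0) ⟩
  R 0 2 + + 2 * R 1 1 + + 1 * R 2 0 ∎
  where
  collect : ∀ a b c → (a + b) + (b + + 1 * c) ≡ a + + 2 * b + + 1 * c
  collect = solve-∀
binomialSum-support≤2 (suc k) R R≥3 = begin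
  binomialSum (2 ℕ.+ k) (λ j i → R j (suc i)) + binomialSum (2 ℕ.+ k) (λ j i → R (suc j) i)
    ≡⟨ cong₂ _+_ (binomialSum-support≤2 k (λ j i → R j (suc i)) (λ j i → R≥3 j (suc i)))
                 (binomialSum-support≤1 (suc k) (λ j i → R (suc j) i) R≥3) ⟩
  (R 0 (3 ℕ.+ k) + x * R 1 (2 ℕ.+ k) + + ((2 ℕ.+ k) C 2) * R 2 (suc k)) + (R 1 (2 ℕ.+ k) + x * R 2 (suc k))
    ≡⟨ collect (R 0 (3 ℕ.+ k)) (R 1 (2 ℕ.+ k)) (R 2 (suc k)) x (+ ((2 ℕ.+ k) C 2)) ⟩
  R 0 (3 ℕ.+ k) + (+ 1 + x) * R 1 (2 ℕ.+ k) + (x + + ((2 ℕ.+ k) C 2)) * R 2 (suc k)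
    ≡⟨ cong (λ c → R 0 (3 ℕ.+ k) + + (3 ℕ.+ k) * R 1 (2 ℕ.+ k) + c * R 2 (suc k)) pascal ⟩
  R 0 (3 ℕ.+ k) + + (3 ℕ.+ k) * R 1 (2 ℕ.+ k) + + ((3 ℕ.+ k) C 2) * R 2 (suc k) ∎
  where
  x : ℤ
  x = + (2 ℕ.+ k)
  collect : ∀ a b c x t → (a + x * b + t * c) + (b + x * c) ≡ a + (+ 1 + x) * b + (x + t) * c
  collect = solve-∀
  pascal : x + + ((2 ℕ.+ k) C 2) ≡ + ((3 ℕ.+ k) C 2)
  pascal = cong +_ (trans (cong (ℕ._+ (2 ℕ.+ k) C 2) (sym (nC1≡n (2 ℕ.+ k))))
                          (nCk+nC[k+1]≡[n+1]C[k+1] (2 ℕ.+ k) 1))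

-- Words and multiplicity profiles

InRange : ℕ → ℕ → Set
InRange m a = 1 ≤ a × a ≤ m

values : ℕ → List ℕ
values m = map suc (upTo m)

values-inRange : ∀ m → All (InRange m) (values m)
values-inRange m = map⁺ (All.map (λ i<m → s≤s z≤n , i<m) (all-upTo m))

values-∷ʳ : ∀ m → values m ∷ʳ suc m ≡ values (suc m)
values-∷ʳ m = trans (sym (map-++ suc (upTo m) [ m ])) (cong (map suc) (upTo-∷ʳ m))

tuples-inRange : ∀ m k → All (λ v → All (InRange m) (toList v)) (tuples m k)
tuples-inRange m zero    = [] ∷ []
tuples-inRange m (suc k) =
  concat⁺ (map⁺ (All.map (λ a∈ → map⁺ (All.map (a∈ ∷_) (tuples-inRange m k))) (values-inRange m)))

sumBy-tuples-suc : ∀ m k (f : Vec ℕ (suc k) → ℤ) →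
  sumBy f (tuples m (suc k)) ≡ sumBy (λ a → sumBy (λ w → f (a ∷ᵛ w)) (tuples m k)) (values m)
sumBy-tuples-suc m k f =
  trans (sumBy-concatMap f _ (values m)) (sumBy-cong (values m) (λ a → sumBy-map f (a ∷ᵛ_) (tuples m k)))

≡ᵇ-refl : ∀ n → (n ≡ᵇ n) ≡ true
≡ᵇ-refl n = dec-true (n ℕₚ.≟ n) refl

≢⇒≡ᵇ-false : ∀ {m n} → m ≢ n → (m ≡ᵇ n) ≡ false
≢⇒≡ᵇ-false {m} {n} = dec-false (m ℕₚ.≟ n)

<⇒<ᵇ-true : ∀ {m n} → m < n → (m <ᵇ n) ≡ true
<⇒<ᵇ-true {m} {n} = dec-true (m ℕₚ.<? n)

≮⇒<ᵇ-false : ∀ {m n} → ¬ m < n → (m <ᵇ n) ≡ false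
≮⇒<ᵇ-false {m} {n} = dec-false (m ℕₚ.<? n)

T-injective : ∀ {a b} → T a ⇔ T b → a ≡ b
T-injective {false} {false} _ = refl
T-injective {false} {true}  e = ⊥-elim (Equivalence.from e _)
T-injective {true}  {false} e = ⊥-elim (Equivalence.to e _)
T-injective {true}  {true}  _ = refl

¬T⇒≡false : ∀ {b} → ¬ T b → b ≡ false
¬T⇒≡false ¬b = ¬-not (¬b ∘ Equivalence.from T-≡)

mult : ℕ → List ℕ → ℕ
mult a = count (_≡ᵇ a)

below : ℕ → List ℕ → ℕ
below a = count (_<ᵇ a)

dropValue : ℕ → List ℕ → List ℕ
dropValue a = filterᵇ (λ b → not (b ≡ᵇ a))

mult-∷-≡ : ∀ a l → mult a (a ∷ l) ≡ suc (mult a l)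
mult-∷-≡ a l rewrite ≡ᵇ-refl a = refl

mult-∷-≢ : ∀ {a b} l → a ≢ b → mult b (a ∷ l) ≡ mult b l
mult-∷-≢ l a≢b rewrite ≢⇒≡ᵇ-false a≢b = refl

dropValue-∷-≡ : ∀ a l → dropValue a (a ∷ l) ≡ dropValue a l
dropValue-∷-≡ a l rewrite ≡ᵇ-refl a = refl

dropValue-∷-≢ : ∀ {a b} l → b ≢ a → dropValue a (b ∷ l) ≡ b ∷ dropValue a l
dropValue-∷-≢ l b≢a rewrite ≢⇒≡ᵇ-false b≢a = refl

mult-dropValue : ∀ {a b} l → b ≢ a → mult b (dropValue a l) ≡ mult b l
mult-dropValue []      b≢a = refl
mult-dropValue {a} {b} (x ∷ l) b≢a with x ℕₚ.≟ a
... | yes refl rewrite ≡ᵇ-refl x = trans (mult-dropValue l b≢a) (sym (mult-∷-≢ l (b≢a ∘ sym)))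
... | no x≢a rewrite ≢⇒≡ᵇ-false x≢a with x ≡ᵇ b
...   | true  = cong suc (mult-dropValue l b≢a)
...   | false = mult-dropValue l b≢a

mult-∷-≤ : ∀ a x l → mult a l ≤ mult a (x ∷ l)
mult-∷-≤ a x l with x ≡ᵇ a
... | true  = ℕₚ.n≤1+n _
... | false = ℕₚ.≤-refl

∈⇒mult-pos : ∀ {a l} → a ∈ l → 0 < mult a l
∈⇒mult-pos {a} {a ∷ l} (here refl) = subst (0 <_) (sym (mult-∷-≡ a l)) z<s
∈⇒mult-pos {a} {x ∷ l} (there a∈l) = ℕₚ.<-≤-trans (∈⇒mult-pos a∈l) (mult-∷-≤ a x l)

mult-pos⇒∈ : ∀ {a} l → 0 < mult a l → a ∈ l
mult-pos⇒∈ {a} (x ∷ l) pos with x ℕₚ.≟ a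
... | yes refl = here refl
... | no  x≢a  = there (mult-pos⇒∈ l (subst (0 <_) (mult-∷-≢ l x≢a) pos))

mult-∷-shift : ∀ r a pre suf → mult r (a ∷ pre) ℕ.+ mult r suf ≡ mult r pre ℕ.+ mult r (a ∷ suf)
mult-∷-shift r a pre suf with a ≡ᵇ r
... | true  = sym (ℕₚ.+-suc _ _)
... | false = refl

data Position : Bool → Bool → Bool → Set where
  before : Position true  true  false
  at     : Position true  false true
  after  : Position false false false

position : ∀ a r → Position (a <ᵇ suc r) (a <ᵇ r) (a ≡ᵇ r)
position zero    zero    = at
position zero    (suc r) = before
position (suc a) zero    = after
position (suc a) (suc r) = position a r

below-suc : ∀ r l → below (suc r) l ≡ below r l ℕ.+ mult r l
below-suc r []      = refl
below-suc r (a ∷ l) with a <ᵇ suc r | a <ᵇ r | a ≡ᵇ r | position a r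
... | _ | _ | _ | before = cong suc (below-suc r l)
... | _ | _ | _ | at     = trans (cong suc (below-suc r l)) (sym (ℕₚ.+-suc _ _))
... | _ | _ | _ | after  = below-suc r l

below-all : ∀ {a} l → All (_< a) l → below a l ≡ length l
below-all []      []           = refl
below-all (x ∷ l) (x<a ∷ l<a) rewrite <⇒<ᵇ-true x<a = cong suc (below-all l l<a)

below-none : ∀ {a} l → All (a ≤_) l → below a l ≡ 0
below-none []      []           = refl
below-none (x ∷ l) (a≤x ∷ a≤l) rewrite ≮⇒<ᵇ-false (ℕₚ.≤⇒≯ a≤x) = below-none l a≤l

below≤length : ∀ a l → below a l ≤ length l
below≤length a []      = z≤n
below≤length a (x ∷ l) with x <ᵇ a
... | true  = s≤s (below≤length a l)
... | false = ℕₚ.m≤n⇒m≤1+n (below≤length a l)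

profile : ℕ → List ℕ → List ℕ
profile zero    l = []
profile (suc m) l = mult (suc m) l ∷ profile m l

length-profile : ∀ m l → length (profile m l) ≡ m
length-profile zero    l = refl
length-profile (suc m) l = cong suc (length-profile m l)

sum-profile : ∀ r l → All (1 ≤_) l → sum (profile r l) ≡ below (suc r) l
sum-profile zero    l l≥1 = sym (below-none l l≥1)
sum-profile (suc r) l l≥1 = begin
  mult (suc r) l ℕ.+ sum (profile r l)  ≡⟨ cong (mult (suc r) l ℕ.+_) (sum-profile r l l≥1) ⟩
  mult (suc r) l ℕ.+ below (suc r) l   ≡⟨ ℕₚ.+-comm (mult (suc r) l) _ ⟩
  below (suc r) l ℕ.+ mult (suc r) l   ≡⟨ below-suc (suc r) l ⟨
  below (suc (suc r)) l                 ∎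

sum-profile-length : ∀ m l → All (InRange m) l → sum (profile m l) ≡ length l
sum-profile-length m l inRange =
  trans (sum-profile m l (All.map proj₁ inRange)) (below-all l (All.map (s≤s ∘ proj₂) inRange))

profile-cong : ∀ m {l l′} → (∀ r → r < m → mult (suc r) l ≡ mult (suc r) l′) → profile m l ≡ profile m l′
profile-cong zero    e = refl
profile-cong (suc m) e = cong₂ _∷_ (e m ℕₚ.≤-refl) (profile-cong m (λ r r<m → e r (ℕₚ.m≤n⇒m≤1+n r<m)))

profile-dropValue : ∀ m l → profile m (dropValue (suc m) l) ≡ profile m l
profile-dropValue m l = profile-cong m (λ r r<m → mult-dropValue l (ℕₚ.<⇒≢ (s≤s r<m)))

-- Deleting the letters m + 1 from a word over {1,…,m+1} leaves a word over {1,…,m}; a word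
-- of length i arises in this way from (i + j choose j) words with j such letters.
sumBy-tuples-split : ∀ m k (H : ℕ → List ℕ → ℤ) →
  sumBy (λ v → H (mult (suc m) (toList v)) (dropValue (suc m) (toList v))) (tuples (suc m) k)
  ≡ binomialSum k (λ j i → sumBy (λ w → H j (toList w)) (tuples m i))
sumBy-tuples-split m zero    H = refl
sumBy-tuples-split m (suc k) H = begin
  sumBy (λ v → H (mult (suc m) (toList v)) (dropValue (suc m) (toList v))) (tuples (suc m) (suc k))
    ≡⟨ sumBy-tuples-suc (suc m) k (λ v → H (mult (suc m) (toList v)) (dropValue (suc m) (toList v))) ⟩
  sumBy S (values (suc m))
    ≡⟨ cong (sumBy S) (values-∷ʳ m) ⟨
  sumBy S (values m ∷ʳ suc m)
    ≡⟨ sumBy-∷ʳ S (values m) (suc m) ⟩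
  sumBy S (values m) + S (suc m)
    ≡⟨ cong₂ _+_ lower top ⟩
  binomialSum k (λ j i → R j (suc i)) + binomialSum k (λ j i → R (suc j) i) ∎
  where
  S : ℕ → ℤ
  S a = sumBy (λ w → H (mult (suc m) (a ∷ toList w)) (dropValue (suc m) (a ∷ toList w))) (tuples (suc m) k)
  R : ℕ → ℕ → ℤ
  R j i = sumBy (λ w → H j (toList w)) (tuples m i)
  top : S (suc m) ≡ binomialSum k (λ j i → R (suc j) i)
  top = trans (sumBy-cong (tuples (suc m) k) (λ w →
                 cong₂ H (mult-∷-≡ (suc m) (toList w)) (dropValue-∷-≡ (suc m) (toList w))))
              (sumBy-tuples-split m k (H ∘ suc))
  S-lower : ∀ {a} → InRange m a → S a ≡ binomialSum k (λ j i → sumBy (λ w → H j (a ∷ toList w)) (tuples m i))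
  S-lower (_ , a≤m) = trans (sumBy-cong (tuples (suc m) k) (λ w →
                               cong₂ H (mult-∷-≢ (toList w) a≢1+m) (dropValue-∷-≢ (toList w) a≢1+m)))
                            (sumBy-tuples-split m k (λ j l → H j (_ ∷ l)))
    where a≢1+m = ℕₚ.<⇒≢ (s≤s a≤m)
  lower : sumBy S (values m) ≡ binomialSum k (λ j i → R j (suc i))
  lower = begin
    sumBy S (values m)
      ≡⟨ sumBy-congᴬ (All.map S-lower (values-inRange m)) ⟩
    sumBy (λ a → binomialSum k (λ j i → sumBy (λ w → H j (a ∷ toList w)) (tuples m i))) (values m)
      ≡⟨ sumBy-binomialSum k _ (values m) ⟩
    binomialSum k (λ j i → sumBy (λ a → sumBy (λ w → H j (a ∷ toList w)) (tuples m i)) (values m))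
      ≡⟨ binomialSum-cong k (λ j i → sumBy-tuples-suc m i (H j ∘ toList)) ⟨
    binomialSum k (λ j i → R j (suc i)) ∎

-- In a profile (c_m, …, c_1), validCount c_r (c_{r-1} + ⋯ + c_1) (r − 1) is the unit Fubini
-- condition at the value r.
validCount : ℕ → ℕ → ℕ → Bool
validCount zero    s r = true
validCount (suc j) s r = (j ≤ᵇ 1) ∧ (s ≡ᵇ r)

valid : List ℕ → Bool
valid []      = true
valid (j ∷ c) = validCount j (sum c) (length c) ∧ valid c

nonzeros : List ℕ → ℕ
nonzeros []          = 0
nonzeros (zero  ∷ c) = nonzeros c
nonzeros (suc _ ∷ c) = suc (nonzeros c)

weight : ℤ → List ℕ → ℤ
weight q c = if valid c then q ℤ.^ nonzeros c else + 0

blockWeight : ℤ → ℕ → ℕ → ℕ → ℤ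
blockWeight q zero    s r = + 1
blockWeight q (suc j) s r = if validCount (suc j) s r then q else + 0

weight-∷ : ∀ q j c → weight q (j ∷ c) ≡ blockWeight q j (sum c) (length c) * weight q c
weight-∷ q zero    c = sym (ℤₚ.*-identityˡ _)
weight-∷ q (suc j) c with (j ≤ᵇ 1) ∧ (sum c ≡ᵇ length c) | valid c
... | true  | true  = refl
... | true  | false = sym (ℤₚ.*-zeroʳ q)
... | false | _     = refl

blockWeight-≡ : ∀ q {j} r → j ≤ 1 → blockWeight q (suc j) r r ≡ q
blockWeight-≡ q {j} r j≤1 rewrite ≡ᵇ-refl r | dec-true (j ℕₚ.≤? 1) j≤1 = refl

blockWeight-≢ : ∀ q j {s r} → s ≢ r → blockWeight q (suc j) s r ≡ + 0
blockWeight-≢ q j s≢r rewrite ≢⇒≡ᵇ-false s≢r | ∧-zeroʳ (j ≤ᵇ 1) = refl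

weightSum : ℤ → ℕ → ℕ → ℤ
weightSum q m k = sumBy (λ v → weight q (profile m (toList v))) (tuples m k)

weightSum-suc : ∀ q m k →
  weightSum q (suc m) k ≡ binomialSum k (λ j i → blockWeight q j i m * weightSum q m i)
weightSum-suc q m k = begin
  weightSum q (suc m) k
    ≡⟨ sumBy-cong (tuples (suc m) k) (λ v → cong (weight q ∘ (mult (suc m) (toList v) ∷_))
                                                 (profile-dropValue m (toList v))) ⟨
  sumBy (λ v → H (mult (suc m) (toList v)) (dropValue (suc m) (toList v))) (tuples (suc m) k)
    ≡⟨ sumBy-tuples-split m k H ⟩
  binomialSum k (λ j i → sumBy (λ w → H j (toList w)) (tuples m i))
    ≡⟨ binomialSum-cong k (λ j i → trans (sumBy-congᴬ (All.map (factor j) (tuples-inRange m i)))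
                                          (sumBy-*ˡ (blockWeight q j i m) (weight q ∘ profile m ∘ toList) (tuples m i))) ⟩
  binomialSum k (λ j i → blockWeight q j i m * weightSum q m i) ∎
  where
  H : ℕ → List ℕ → ℤ
  H j l = weight q (j ∷ profile m l)
  factor : ∀ j {i} {w : Vec ℕ i} → All (InRange m) (toList w) →
           H j (toList w) ≡ blockWeight q j i m * weight q (profile m (toList w))
  factor j {i} {w} inRange = trans (weight-∷ q j (profile m (toList w)))
    (cong₂ (λ s r → blockWeight q j s r * weight q (profile m (toList w)))
           (trans (sum-profile-length m (toList w) inRange) (length-toList w)) (length-profile m (toList w)))

weightSum-suc-expanded : ∀ q m k → weightSum q (suc m) (2 ℕ.+ k)
  ≡ weightSum q m (2 ℕ.+ k) + + (2 ℕ.+ k) * (blockWeight q 1 (suc k) m * weightSum q m (suc k))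
                             + + ((2 ℕ.+ k) C 2) * (blockWeight q 2 k m * weightSum q m k)
weightSum-suc-expanded q m k = trans (weightSum-suc q m (2 ℕ.+ k))
  (trans (binomialSum-support≤2 k (λ j i → blockWeight q j i m * weightSum q m i) (λ _ _ → refl))
         (cong (λ a → a + y + z) (ℤₚ.*-identityˡ (weightSum q m (2 ℕ.+ k)))))
  where
  y z : ℤ
  y = + (2 ℕ.+ k) * (blockWeight q 1 (suc k) m * weightSum q m (suc k))
  z = + ((2 ℕ.+ k) C 2) * (blockWeight q 2 k m * weightSum q m k)

weightSum-vanishes : ∀ q m k → 2 ℕ.+ m ≤ k → weightSum q m k ≡ + 0
weightSum-vanishes q zero    (suc k) _ = refl
weightSum-vanishes q (suc m) (suc (suc (suc k))) (s≤s (s≤s (s≤s m≤k))) = begin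
  weightSum q (suc m) (3 ℕ.+ k)
    ≡⟨ weightSum-suc-expanded q m (suc k) ⟩
  weightSum q m (3 ℕ.+ k) + x * (blockWeight q 1 (2 ℕ.+ k) m * weightSum q m (2 ℕ.+ k))
                          + t * (blockWeight q 2 (suc k) m * weightSum q m (suc k))
    ≡⟨ cong₂ _+_ (cong₂ _+_ (weightSum-vanishes q m (3 ℕ.+ k) (s≤s (s≤s (ℕₚ.m≤n⇒m≤1+n m≤k))))
                            (cong (λ w → x * (blockWeight q 1 (2 ℕ.+ k) m * w))
                                  (weightSum-vanishes q m (2 ℕ.+ k) (s≤s (s≤s m≤k)))))
                 (cong (λ b → t * (b * weightSum q m (suc k))) (blockWeight-≢ q 1 (ℕₚ.>⇒≢ (s≤s m≤k)))) ⟩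
  + 0 + x * (blockWeight q 1 (2 ℕ.+ k) m * + 0) + t * (+ 0 * weightSum q m (suc k))
    ≡⟨ annihilate x t (blockWeight q 1 (2 ℕ.+ k) m) (weightSum q m (suc k)) ⟩
  + 0 ∎
  where
  x t : ℤ
  x = + (3 ℕ.+ k)
  t = + ((3 ℕ.+ k) C 2)
  annihilate : ∀ x t b w → + 0 + x * (b * + 0) + t * (+ 0 * w) ≡ + 0
  annihilate = solve-∀

weightSum-diagonal : ∀ q m →
  weightSum q (suc m) (suc m) ≡ weightSum q m (suc m) + + suc m * (q * weightSum q m m)
weightSum-diagonal q zero    = trans (weightSum-suc q 0 1) (rearrange q (weightSum q 0 1) (weightSum q 0 0))
  where
  rearrange : ∀ q a b → + 1 * a + q * b ≡ a + + 1 * (q * b)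
  rearrange = solve-∀
weightSum-diagonal q (suc m) = begin
  weightSum q (2 ℕ.+ m) (2 ℕ.+ m)
    ≡⟨ weightSum-suc-expanded q (suc m) m ⟩
  weightSum q (suc m) (2 ℕ.+ m) + x * (blockWeight q 1 (suc m) (suc m) * weightSum q (suc m) (suc m))
                                + t * (blockWeight q 2 m (suc m) * weightSum q (suc m) m)
    ≡⟨ cong₂ (λ b b′ → weightSum q (suc m) (2 ℕ.+ m) + x * (b * weightSum q (suc m) (suc m))
                                                      + t * (b′ * weightSum q (suc m) m))
             (blockWeight-≡ q (suc m) z≤n) (blockWeight-≢ q 1 (ℕₚ.1+n≢n {m} ∘ sym)) ⟩
  weightSum q (suc m) (2 ℕ.+ m) + x * (q * weightSum q (suc m) (suc m)) + t * (+ 0 * weightSum q (suc m) m)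
    ≡⟨ drop-last (weightSum q (suc m) (2 ℕ.+ m)) (q * weightSum q (suc m) (suc m)) (weightSum q (suc m) m) x t ⟩
  weightSum q (suc m) (2 ℕ.+ m) + x * (q * weightSum q (suc m) (suc m)) ∎
  where
  x t : ℤ
  x = + (2 ℕ.+ m)
  t = + ((2 ℕ.+ m) C 2)
  drop-last : ∀ a b w x t → a + x * b + t * (+ 0 * w) ≡ a + x * b
  drop-last = solve-∀

weightSum-superdiagonal : ∀ q m → weightSum q (suc m) (2 ℕ.+ m) ≡ + ((2 ℕ.+ m) C 2) * (q * weightSum q m m)
weightSum-superdiagonal q m = begin
  weightSum q (suc m) (2 ℕ.+ m)
    ≡⟨ weightSum-suc-expanded q m m ⟩
  weightSum q m (2 ℕ.+ m) + x * (blockWeight q 1 (suc m) m * weightSum q m (suc m))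
                          + t * (blockWeight q 2 m m * weightSum q m m)
    ≡⟨ cong₂ _+_ (cong₂ (λ w b → w + x * (b * weightSum q m (suc m)))
                        (weightSum-vanishes q m (2 ℕ.+ m) ℕₚ.≤-refl) (blockWeight-≢ q 0 (ℕₚ.1+n≢n {m})))
                 (cong (λ b → t * (b * weightSum q m m)) (blockWeight-≡ q m (s≤s z≤n))) ⟩
  + 0 + x * (+ 0 * weightSum q m (suc m)) + t * (q * weightSum q m m)
    ≡⟨ keep-last (weightSum q m (suc m)) (q * weightSum q m m) x t ⟩
  t * (q * weightSum q m m) ∎
  where
  x t : ℤ
  x = + (2 ℕ.+ m)
  t = + ((2 ℕ.+ m) C 2)
  keep-last : ∀ w b x t → + 0 + x * (+ 0 * w) + t * b ≡ t * b
  keep-last = solve-∀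

weightSum-diagonal-recurrence : ∀ q m → weightSum q (2 ℕ.+ m) (2 ℕ.+ m)
  ≡ + (2 ℕ.+ m) * (q * weightSum q (suc m) (suc m)) + + ((2 ℕ.+ m) C 2) * (q * weightSum q m m)
weightSum-diagonal-recurrence q m = begin
  weightSum q (2 ℕ.+ m) (2 ℕ.+ m)
    ≡⟨ weightSum-diagonal q (suc m) ⟩
  weightSum q (suc m) (2 ℕ.+ m) + x * (q * weightSum q (suc m) (suc m))
    ≡⟨ cong (_+ x * (q * weightSum q (suc m) (suc m))) (weightSum-superdiagonal q m) ⟩
  t * (q * weightSum q m m) + x * (q * weightSum q (suc m) (suc m))
    ≡⟨ ℤₚ.+-comm (t * (q * weightSum q m m)) _ ⟩
  x * (q * weightSum q (suc m) (suc m)) + t * (q * weightSum q m m) ∎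
  where
  x t : ℤ
  x = + (2 ℕ.+ m)
  t = + ((2 ℕ.+ m) C 2)

weightSum-1 : ∀ q → weightSum q 1 1 ≡ q
weightSum-1 q = trans (ℤₚ.+-identityʳ (q * + 1)) (ℤₚ.*-identityʳ q)

-- Unit Fubini rankings and lucky cars

UnitFubiniAt : List ℕ → ℕ → Set
UnitFubiniAt l a = a ∈ l → mult a l ≤ 2 × a ≡ suc (below a l)

UnitFubiniUpTo : ℕ → List ℕ → Set
UnitFubiniUpTo m l = ∀ r → r < m → UnitFubiniAt l (suc r)

isUnitFubini⇔ : ∀ l → T (isFubini l ∧ isUnit l) ⇔ (∀ a → UnitFubiniAt l a)
isUnitFubini⇔ l = mk⇔ to from
  where
  to : T (isFubini l ∧ isUnit l) → ∀ a → UnitFubiniAt l a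
  to t a a∈l with Equivalence.to T-∧ t
  ... | fubini , unit = ℕₚ.≤ᵇ⇒≤ _ 2 (All.lookup (all⁺ _ l unit) a∈l) ,
                        ℕₚ.≡ᵇ⇒≡ _ _ (All.lookup (all⁺ _ l fubini) a∈l)
  from : (∀ a → UnitFubiniAt l a) → T (isFubini l ∧ isUnit l)
  from h = Equivalence.from T-∧
    ( all⁻ _ (All.tabulate (λ a∈l → ℕₚ.≡⇒≡ᵇ _ _ (proj₂ (h _ a∈l))))
    , all⁻ _ (All.tabulate (λ a∈l → ℕₚ.≤⇒≤ᵇ (proj₁ (h _ a∈l)))))

UnitFubini⇔UpTo : ∀ n l → All (InRange n) l → (∀ a → UnitFubiniAt l a) ⇔ UnitFubiniUpTo n l
UnitFubini⇔UpTo n l inRange = mk⇔ (λ h r _ → h (suc r)) from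
  where
  from : UnitFubiniUpTo n l → ∀ a → UnitFubiniAt l a
  from h a a∈l with All.lookup inRange a∈l
  ... | s≤s z≤n , a≤n = h _ a≤n a∈l

UnitFubiniUpTo-suc : ∀ m l → (UnitFubiniAt l (suc m) × UnitFubiniUpTo m l) ⇔ UnitFubiniUpTo (suc m) l
UnitFubiniUpTo-suc m l = mk⇔ to (λ h → h m ℕₚ.≤-refl , λ r r<m → h r (ℕₚ.m≤n⇒m≤1+n r<m))
  where
  to : UnitFubiniAt l (suc m) × UnitFubiniUpTo m l → UnitFubiniUpTo (suc m) l
  to (top , lower) r r<1+m with ℕₚ.m<1+n⇒m<n∨m≡n r<1+m
  ... | inj₁ r<m  = lower r r<m
  ... | inj₂ refl = top

validCount⇔ : ∀ r l → T (validCount (mult (suc r) l) (below (suc r) l) r) ⇔ UnitFubiniAt l (suc r)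
validCount⇔ r l = by-multiplicity (mult (suc r) l) refl
  where
  by-multiplicity : ∀ c → mult (suc r) l ≡ c →
                    T (validCount c (below (suc r) l) r) ⇔ UnitFubiniAt l (suc r)
  by-multiplicity zero    eq = mk⇔ (λ _ r∈l → ⊥-elim (ℕₚ.<-irrefl (sym eq) (∈⇒mult-pos r∈l))) _
  by-multiplicity (suc j) eq = mk⇔ to from
    where
    to : T ((j ≤ᵇ 1) ∧ (below (suc r) l ≡ᵇ r)) → UnitFubiniAt l (suc r)
    to t _ with Equivalence.to T-∧ t
    ... | j≤1 , below≡r = subst (_≤ 2) (sym eq) (s≤s (ℕₚ.≤ᵇ⇒≤ j 1 j≤1)) ,
                          cong suc (sym (ℕₚ.≡ᵇ⇒≡ _ r below≡r))
    from : UnitFubiniAt l (suc r) → T ((j ≤ᵇ 1) ∧ (below (suc r) l ≡ᵇ r))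
    from h with h (mult-pos⇒∈ l (subst (0 <_) (sym eq) z<s))
    ... | two , r≡below = Equivalence.from T-∧
      (ℕₚ.≤⇒≤ᵇ (ℕₚ.≤-pred (subst (_≤ 2) eq two)) , ℕₚ.≡⇒≡ᵇ _ r (sym (ℕₚ.suc-injective r≡below)))

valid-profile-suc : ∀ m l → All (1 ≤_) l →
  valid (profile (suc m) l) ≡ validCount (mult (suc m) l) (below (suc m) l) m ∧ valid (profile m l)
valid-profile-suc m l l≥1 =
  cong₂ (λ s r → validCount (mult (suc m) l) s r ∧ valid (profile m l)) (sum-profile m l l≥1) (length-profile m l)

valid-profile⇔ : ∀ m l → All (1 ≤_) l → T (valid (profile m l)) ⇔ UnitFubiniUpTo m l
valid-profile⇔ zero    l l≥1 = mk⇔ (λ _ r ()) _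
valid-profile⇔ (suc m) l l≥1 rewrite valid-profile-suc m l l≥1 =
  ⇔.trans T-∧ (⇔.trans (validCount⇔ m l ×-⇔ valid-profile⇔ m l l≥1) (UnitFubiniUpTo-suc m l))

isUnitFubini≡valid : ∀ n l → All (InRange n) l → isFubini l ∧ isUnit l ≡ valid (profile n l)
isUnitFubini≡valid n l inRange = T-injective
  (⇔.trans (isUnitFubini⇔ l) (⇔.trans (UnitFubini⇔UpTo n l inRange) (⇔.sym (valid-profile⇔ n l (All.map proj₁ inRange)))))

distinctValues : ℕ → List ℕ → ℕ
distinctValues n l = nonzeros (profile n l)

distinctValues-[] : ∀ n → distinctValues n [] ≡ 0
distinctValues-[] zero    = refl
distinctValues-[] (suc n) = distinctValues-[] n

fresh : ℕ → ℕ
fresh zero    = 1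
fresh (suc _) = 0

distinctValues-∷ : ∀ n {a} l → InRange n a → distinctValues n (a ∷ l) ≡ fresh (mult a l) ℕ.+ distinctValues n l
distinctValues-∷ zero    l (s≤s _ , ())
distinctValues-∷ (suc n) {a} l (1≤a , a≤1+n) with a ℕₚ.≟ suc n
... | yes refl = begin
  nonzeros (mult (suc n) (suc n ∷ l) ∷ profile n (suc n ∷ l))
    ≡⟨ cong₂ (λ c p → nonzeros (c ∷ p)) (mult-∷-≡ (suc n) l)
             (profile-cong n (λ r r<n → mult-∷-≢ l (ℕₚ.>⇒≢ (s≤s r<n)))) ⟩
  suc (nonzeros (profile n l))
    ≡⟨ nonzeros-fresh (mult (suc n) l) (profile n l) ⟩
  fresh (mult (suc n) l) ℕ.+ nonzeros (mult (suc n) l ∷ profile n l) ∎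
  where
  nonzeros-fresh : ∀ j c → suc (nonzeros c) ≡ fresh j ℕ.+ nonzeros (j ∷ c)
  nonzeros-fresh zero    c = refl
  nonzeros-fresh (suc j) c = refl
... | no a≢1+n = begin
  nonzeros (mult (suc n) (a ∷ l) ∷ profile n (a ∷ l))
    ≡⟨ cong (λ c → nonzeros (c ∷ profile n (a ∷ l))) (mult-∷-≢ l a≢1+n) ⟩
  nonzeros (mult (suc n) l ∷ profile n (a ∷ l))
    ≡⟨ nonzeros-∷ (mult (suc n) l) (distinctValues-∷ n l (1≤a , ℕₚ.≤-pred (ℕₚ.≤∧≢⇒< a≤1+n a≢1+n))) ⟩
  fresh (mult a l) ℕ.+ nonzeros (mult (suc n) l ∷ profile n l) ∎
  where
  nonzeros-∷ : ∀ j {c c′ f} → nonzeros c′ ≡ f ℕ.+ nonzeros c → nonzeros (j ∷ c′) ≡ f ℕ.+ nonzeros (j ∷ c)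
  nonzeros-∷ zero    e = e
  nonzeros-∷ (suc j) e = trans (cong suc e) (sym (ℕₚ.+-suc _ _))

parkLucky-free : ∀ {n occ a} suf → a ≤ n → ¬ T (a ∈ᵇ occ) → parkLucky n occ (a ∷ suf) ≡ suc (parkLucky n (a ∷ occ) suf)
parkLucky-free {n} {occ} {a} suf a≤n free
  rewrite dec-true (a ℕₚ.≤? n) a≤n | ¬T⇒≡false free | ≡ᵇ-refl a = refl

parkLucky-next : ∀ {n occ a} suf → T (a ∈ᵇ occ) → suc a ≤ n → ¬ T (suc a ∈ᵇ occ) →
  parkLucky n occ (a ∷ suf) ≡ parkLucky n (suc a ∷ occ) suf
parkLucky-next {suc n} {occ} {a} suf taken 1+a≤n free
  rewrite dec-true (a ℕₚ.≤? suc n) (ℕₚ.m≤n⇒m≤1+n (ℕₚ.≤-pred 1+a≤n)) | Equivalence.to T-≡ taken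
        | dec-true (suc a ℕₚ.≤? suc n) 1+a≤n | ¬T⇒≡false free | ≢⇒≡ᵇ-false (ℕₚ.1+n≢n {a}) = refl

-- After the cars of pre have parked, the taken spots are the values of pre and b + 1 for
-- every value b occurring twice in pre.
Taken : List ℕ → ℕ → Set
Taken pre s = 0 < mult s pre ⊎ ∃[ b ] (s ≡ suc b × 2 ≤ mult b pre)

record Invariant (occ pre : List ℕ) : Set where
  field
    occupied⇒taken : ∀ s → T (s ∈ᵇ occ) → Taken pre s
    values-occupied : ∀ s → 0 < mult s pre → T (s ∈ᵇ occ)

Invariant-∷ : ∀ {occ pre a s′} → Invariant occ pre → Taken (a ∷ pre) s′ → T (a ∈ᵇ (s′ ∷ occ)) →
  Invariant (s′ ∷ occ) (a ∷ pre)
Invariant-∷ {occ} {pre} {a} {s′} inv taken a-occupied = record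
  { occupied⇒taken = λ s t → [ (λ e → subst (Taken (a ∷ pre)) (ℕₚ.≡ᵇ⇒≡ s′ s e) taken)
                            , (weaken ∘ occupied⇒taken s) ]′ (Equivalence.to T-∨ t)
  ; values-occupied = values-occupied′ }
  where
  open Invariant inv
  weaken : ∀ {s} → Taken pre s → Taken (a ∷ pre) s
  weaken (inj₁ pos)             = inj₁ (ℕₚ.<-≤-trans pos (mult-∷-≤ _ a pre))
  weaken (inj₂ (b , e , two))   = inj₂ (b , e , ℕₚ.≤-trans two (mult-∷-≤ b a pre))
  values-occupied′ : ∀ s → 0 < mult s (a ∷ pre) → T (s ∈ᵇ (s′ ∷ occ))
  values-occupied′ s pos with a ℕₚ.≟ s
  ... | yes refl = a-occupied
  ... | no a≢s   = Equivalence.from T-∨ (inj₂ (values-occupied s (subst (0 <_) (mult-∷-≢ pre a≢s) pos)))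

module Parking (n : ℕ) (l : List ℕ)
  (atMostTwice   : ∀ a → mult a l ≤ 2)
  (gapAfterPair  : ∀ a → 2 ≤ mult a l → mult (suc a) l ≡ 0)
  (roomAfterPair : ∀ a → 2 ≤ mult a l → suc a ≤ n) where

  module _ {occ pre a suf} (inv : Invariant occ pre)
           (split : ∀ r → mult r pre ℕ.+ mult r (a ∷ suf) ≡ mult r l) where
    open Invariant inv

    pre≤l : ∀ r → mult r pre ≤ mult r l
    pre≤l r = subst (mult r pre ≤_) (split r) (ℕₚ.m≤m+n _ _)

    mult-a : mult a l ≡ suc (mult a pre ℕ.+ mult a suf)
    mult-a = trans (sym (split a)) (trans (cong (mult a pre ℕ.+_) (mult-∷-≡ a suf)) (ℕₚ.+-suc _ _))

    first-occurrence-free : mult a pre ≡ 0 → ¬ T (a ∈ᵇ occ)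
    first-occurrence-free eq t with occupied⇒taken a t
    ... | inj₁ pos              = ℕₚ.<-irrefl (sym eq) pos
    ... | inj₂ (b , refl , two) =
      ℕₚ.<-irrefl (sym (gapAfterPair b (ℕₚ.≤-trans two (pre≤l b)))) (subst (0 <_) (sym mult-a) z<s)

    second-occurrence-pair : mult a pre ≡ 1 → 2 ≤ mult a l
    second-occurrence-pair eq =
      subst (2 ≤_) (sym mult-a) (subst (λ c → 2 ≤ suc (c ℕ.+ mult a suf)) (sym eq) (s≤s (s≤s z≤n)))

    second-occurrence-next-free : mult a pre ≡ 1 → ¬ T (suc a ∈ᵇ occ)
    second-occurrence-next-free eq t with occupied⇒taken (suc a) t
    ... | inj₁ pos               =
      ℕₚ.<-irrefl (sym (gapAfterPair a (second-occurrence-pair eq))) (ℕₚ.<-≤-trans pos (pre≤l (suc a)))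
    ... | inj₂ (.a , refl , two) = ℕₚ.<-irrefl refl (subst (2 ≤_) eq two)

    no-third-occurrence : ∀ c → mult a pre ≢ 2 ℕ.+ c
    no-third-occurrence c eq = ℕₚ.<-irrefl refl (ℕₚ.≤-trans three (atMostTwice a))
      where
      three : 3 ≤ mult a l
      three = subst (3 ≤_) (sym mult-a) (subst (λ c′ → 3 ≤ suc (c′ ℕ.+ mult a suf)) (sym eq) (s≤s (s≤s (s≤s z≤n))))

  parkLucky-distinct : ∀ suf pre occ → Invariant occ pre → (∀ r → mult r pre ℕ.+ mult r suf ≡ mult r l) →
    All (InRange n) suf → parkLucky n occ suf ℕ.+ distinctValues n pre ≡ distinctValues n l
  parkLucky-distinct [] pre occ _ split _ =
    cong nonzeros (profile-cong n (λ r _ → trans (sym (ℕₚ.+-identityʳ _)) (split (suc r))))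
  parkLucky-distinct (a ∷ suf) pre occ inv split (a∈ ∷ suf∈) = by-multiplicity (mult a pre) refl
    where
    open Invariant inv
    continue : ∀ s′ → Taken (a ∷ pre) s′ → T (a ∈ᵇ (s′ ∷ occ)) →
      parkLucky n (s′ ∷ occ) suf ℕ.+ distinctValues n (a ∷ pre) ≡ distinctValues n l
    continue s′ taken a-occupied = parkLucky-distinct suf (a ∷ pre) (s′ ∷ occ) (Invariant-∷ inv taken a-occupied)
                                     (λ r → trans (mult-∷-shift r a pre suf) (split r)) suf∈
    distinct-a∷pre : ∀ {c} → mult a pre ≡ c → distinctValues n (a ∷ pre) ≡ fresh c ℕ.+ distinctValues n pre
    distinct-a∷pre eq = trans (distinctValues-∷ n pre a∈) (cong (λ c → fresh c ℕ.+ distinctValues n pre) eq)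
    by-multiplicity : ∀ c → mult a pre ≡ c → parkLucky n occ (a ∷ suf) ℕ.+ distinctValues n pre ≡ distinctValues n l
    by-multiplicity 0 eq = begin
      parkLucky n occ (a ∷ suf) ℕ.+ distinctValues n pre
        ≡⟨ cong (ℕ._+ distinctValues n pre) (parkLucky-free suf (proj₂ a∈) (first-occurrence-free inv split eq)) ⟩
      suc (parkLucky n (a ∷ occ) suf ℕ.+ distinctValues n pre)
        ≡⟨ ℕₚ.+-suc _ _ ⟨
      parkLucky n (a ∷ occ) suf ℕ.+ suc (distinctValues n pre)
        ≡⟨ cong (parkLucky n (a ∷ occ) suf ℕ.+_) (distinct-a∷pre eq) ⟨
      parkLucky n (a ∷ occ) suf ℕ.+ distinctValues n (a ∷ pre)
        ≡⟨ continue a (inj₁ (subst (0 <_) (sym (mult-∷-≡ a pre)) z<s))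
                      (Equivalence.from T-∨ (inj₁ (ℕₚ.≡⇒≡ᵇ a a refl))) ⟩
      distinctValues n l ∎
    by-multiplicity 1 eq = begin
      parkLucky n occ (a ∷ suf) ℕ.+ distinctValues n pre
        ≡⟨ cong (ℕ._+ distinctValues n pre) (parkLucky-next suf a-occupied
                  (roomAfterPair a (second-occurrence-pair inv split eq)) (second-occurrence-next-free inv split eq)) ⟩
      parkLucky n (suc a ∷ occ) suf ℕ.+ distinctValues n pre
        ≡⟨ cong (parkLucky n (suc a ∷ occ) suf ℕ.+_) (distinct-a∷pre eq) ⟨
      parkLucky n (suc a ∷ occ) suf ℕ.+ distinctValues n (a ∷ pre)
        ≡⟨ continue (suc a) (inj₂ (a , refl , subst (2 ≤_) (sym (trans (mult-∷-≡ a pre) (cong suc eq))) ℕₚ.≤-refl))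
                            (Equivalence.from T-∨ (inj₂ a-occupied)) ⟩
      distinctValues n l ∎
      where
      a-occupied : T (a ∈ᵇ occ)
      a-occupied = values-occupied a (subst (0 <_) (sym eq) z<s)
    by-multiplicity (suc (suc c)) eq = ⊥-elim (no-third-occurrence inv split c eq)

module UnitFubiniFacts (l : List ℕ) (ufr : ∀ a → UnitFubiniAt l a) where

  atMostTwice : ∀ a → mult a l ≤ 2
  atMostTwice a = by-multiplicity (mult a l) refl
    where
    by-multiplicity : ∀ c → mult a l ≡ c → c ≤ 2
    by-multiplicity zero    _  = z≤n
    by-multiplicity (suc c) eq =
      subst (_≤ 2) eq (proj₁ (ufr a (mult-pos⇒∈ l (subst (0 <_) (sym eq) z<s))))

  pair⇒below : ∀ a → 2 ≤ mult a l → suc a ≤ below (suc a) l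
  pair⇒below a two = subst₂ _≤_ (cong suc (sym a≡1+below)) (sym below≡)
                              (ℕₚ.+-monoˡ-≤ (below a l) two)
    where
    a≡1+below : a ≡ suc (below a l)
    a≡1+below = proj₂ (ufr a (mult-pos⇒∈ l (ℕₚ.≤-trans (s≤s z≤n) two)))
    below≡ : below (suc a) l ≡ mult a l ℕ.+ below a l
    below≡ = trans (below-suc a l) (ℕₚ.+-comm (below a l) (mult a l))

  gapAfterPair : ∀ a → 2 ≤ mult a l → mult (suc a) l ≡ 0
  gapAfterPair a two = by-multiplicity (mult (suc a) l) refl
    where
    by-multiplicity : ∀ c → mult (suc a) l ≡ c → c ≡ 0
    by-multiplicity zero    _  = refl
    by-multiplicity (suc c) eq = ⊥-elim (ℕₚ.<-irrefl a≡below (pair⇒below a two))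
      where
      a≡below : a ≡ below (suc a) l
      a≡below = ℕₚ.suc-injective (proj₂ (ufr (suc a) (mult-pos⇒∈ l (subst (0 <_) (sym eq) z<s))))

  roomAfterPair : ∀ a → 2 ≤ mult a l → suc a ≤ length l
  roomAfterPair a two = ℕₚ.≤-trans (pair⇒below a two) (below≤length (suc a) l)

lucky≡distinctValues : ∀ n (v : Vec ℕ n) → All (InRange n) (toList v) → (∀ a → UnitFubiniAt (toList v) a) →
  lucky v ≡ distinctValues n (toList v)
lucky≡distinctValues n v inRange ufr = begin
  lucky v                                              ≡⟨ ℕₚ.+-identityʳ _ ⟨
  lucky v ℕ.+ 0                                        ≡⟨ cong (lucky v ℕ.+_) (distinctValues-[] n) ⟨
  parkLucky n [] (toList v) ℕ.+ distinctValues n []    ≡⟨ parkLucky-distinct (toList v) [] [] empty (λ _ → refl) inRange ⟩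
  distinctValues n (toList v)                          ∎
  where
  open UnitFubiniFacts (toList v) ufr
  open Parking n (toList v) atMostTwice gapAfterPair
                 (λ a two → subst (suc a ≤_) (length-toList v) (roomAfterPair a two))
  empty : Invariant [] []
  empty = record { occupied⇒taken = λ _ () ; values-occupied = λ _ () }

ufrSummand≡weight : ∀ q n (v : Vec ℕ n) → All (InRange n) (toList v) →
  (if isFubini (toList v) ∧ isUnit (toList v) then q ℤ.^ lucky v else + 0) ≡ weight q (profile n (toList v))
ufrSummand≡weight q n v inRange rewrite isUnitFubini≡valid n (toList v) inRange
  with valid (profile n (toList v)) in isValid
... | true  = cong (q ℤ.^_) (lucky≡distinctValues n v inRange ufr)
  where
  ufr : ∀ a → UnitFubiniAt (toList v) a
  ufr = Equivalence.from (UnitFubini⇔UpTo n (toList v) inRange)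
          (Equivalence.to (valid-profile⇔ n (toList v) (All.map proj₁ inRange)) (Equivalence.from T-≡ isValid))
... | false = refl

luckyGF≡weightSum : ∀ q n → luckyGF q n ≡ weightSum q n n
luckyGF≡weightSum q n = trans (sumBy-filterᵇ _ (λ α → q ℤ.^ lucky α) (tuples n n))
                              (sumBy-congᴬ (All.map (ufrSummand≡weight q n _) (tuples-inRange n n)))

-- The closed form in ℤ[√D]

2*[n+1]C2 : ∀ n → 2 ℕ.* (suc n C 2) ≡ suc n ℕ.* n
2*[n+1]C2 zero    = refl
2*[n+1]C2 (suc n) = begin
  2 ℕ.* ((2 ℕ.+ n) C 2)                  ≡⟨ cong (2 ℕ.*_) (nCk+nC[k+1]≡[n+1]C[k+1] (suc n) 1) ⟨
  2 ℕ.* (suc n C 1 ℕ.+ suc n C 2)        ≡⟨ cong (λ c → 2 ℕ.* (c ℕ.+ suc n C 2)) (nC1≡n (suc n)) ⟩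
  2 ℕ.* (suc n ℕ.+ suc n C 2)            ≡⟨ ℕₚ.*-distribˡ-+ 2 (suc n) (suc n C 2) ⟩
  2 ℕ.* suc n ℕ.+ 2 ℕ.* (suc n C 2)      ≡⟨ cong (2 ℕ.* suc n ℕ.+_) (2*[n+1]C2 n) ⟩
  2 ℕ.* suc n ℕ.+ suc n ℕ.* n            ≡⟨ collect n ⟩
  (2 ℕ.+ n) ℕ.* suc n                    ∎
  where
  collect : ∀ n → 2 ℕ.* suc n ℕ.+ suc n ℕ.* n ≡ (2 ℕ.+ n) ℕ.* suc n
  collect = ℕ-Solver.solve-∀

module ConjugateInℤ√ (D : ℤ) where
  open Quad D

  conj : ℤ√ → ℤ√
  conj (a , b) = (a , ℤ.- b)

  conj-⊗ : ∀ u v → conj (u ⊗ v) ≡ conj u ⊗ conj v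
  conj-⊗ (a , b) (c , d) = cong₂ _,_ (rational D a b c d) (irrational a b c d)
    where
    rational : ∀ D a b c d → a * c + D * (b * d) ≡ a * c + D * (ℤ.- b * ℤ.- d)
    rational = solve-∀
    irrational : ∀ a b c d → ℤ.- (a * d + b * c) ≡ a * ℤ.- d + ℤ.- b * c
    irrational = solve-∀

  conj-⊘ : ∀ u k → conj u ⊘ k ≡ conj (u ⊘ k)
  conj-⊘ u zero    = refl
  conj-⊘ u (suc k) = trans (cong (conj u ⊗_) (conj-⊘ u k)) (sym (conj-⊗ u (u ⊘ k)))

  ι⊗[u⊖conj-u] : ∀ c u → ι c ⊗ (u ⊖ conj u) ≡ (+ 0 , c * (+ 2 * proj₂ u))
  ι⊗[u⊖conj-u] c (a , b) = cong₂ _,_ (rational D c a b) (irrational c a b)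
    where
    rational : ∀ D c a b → c * (a ℤ.- a) + D * (+ 0 * (b ℤ.- ℤ.- b)) ≡ + 0
    rational = solve-∀
    irrational : ∀ c a b → c * (b ℤ.- ℤ.- b) + + 0 * (a ℤ.- a) ≡ c * (+ 2 * b)
    irrational = solve-∀

  ι⊗√D⊗ι : ∀ c a → ι c ⊗ (√D ⊗ ι a) ≡ (+ 0 , c * a)
  ι⊗√D⊗ι c a = cong₂ _,_ (rational D c a) (irrational D c a)
    where
    rational : ∀ D c a → c * (+ 0 * a + D * (+ 1 * + 0)) + D * (+ 0 * (+ 0 * + 0 + + 1 * a)) ≡ + 0
    rational = solve-∀
    irrational : ∀ D c a → c * (+ 0 * + 0 + + 1 * a) + + 0 * (+ 0 * a + D * (+ 1 * + 0)) ≡ c * a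
    irrational = solve-∀

module ClosedForm (q : ℤ) where
  open Quad (q * (q + + 2))
  open ConjugateInℤ√ (q * (q + + 2))

  α : ℤ√
  α = (q , + 1)

  ι⊕√D≡α : ι q ⊕ √D ≡ α
  ι⊕√D≡α = cong (_, + 1) (ℤₚ.+-identityʳ q)

  ι⊖√D≡conj-α : ι q ⊖ √D ≡ conj α
  ι⊖√D≡conj-α = cong (_, ℤ.- + 1) (ℤₚ.+-identityʳ q)

  β : ℕ → ℤ
  β k = proj₂ (α ⊘ k)

  -- α² = 2q·α + 2q, because D = q² + 2q.
  β-recurrence : ∀ k → β (2 ℕ.+ k) ≡ + 2 * q * β (suc k) + + 2 * q * β k
  β-recurrence k = square q (proj₁ (α ⊘ k)) (β k)
    where
    square : ∀ q P Q → q * (q * Q + + 1 * P) + + 1 * (q * P + q * (q + + 2) * (+ 1 * Q))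
                       ≡ + 2 * q * (q * Q + + 1 * P) + + 2 * q * Q
    square = solve-∀

  module _ (a : ℕ → ℤ) (a₀ : a 0 ≡ + 1) (a₁ : a 1 ≡ q)
    (rec : ∀ m → a (2 ℕ.+ m) ≡ + (2 ℕ.+ m) * (q * a (suc m)) + + ((2 ℕ.+ m) C 2) * (q * a m)) where

    closed-form-step : ∀ m → + (2 ^ m) * a m ≡ + (m !) * β (suc m) →
      + (2 ^ suc m) * a (suc m) ≡ + (suc m !) * β (2 ℕ.+ m) →
      + (2 ^ (2 ℕ.+ m)) * a (2 ℕ.+ m) ≡ + ((2 ℕ.+ m) !) * β (3 ℕ.+ m)
    closed-form-step m ih₀ ih₁ = begin
      + (2 ^ (2 ℕ.+ m)) * a (2 ℕ.+ m)
        ≡⟨ cong₂ _*_ (trans (ℤₚ.pos-* 2 (2 ^ suc m)) (cong (+ 2 *_) (ℤₚ.pos-* 2 (2 ^ m)))) (rec m) ⟩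
      (+ 2 * (+ 2 * p)) * (x₂ * (q * a (suc m)) + t * (q * a m))
        ≡⟨ regroup p (a m) (a (suc m)) x₂ t q ⟩
      (+ 2 * x₂ * q) * ((+ 2 * p) * a (suc m)) + (+ 2 * q) * ((+ 2 * t) * (p * a m))
        ≡⟨ cong₂ (λ u v → (+ 2 * x₂ * q) * u + (+ 2 * q) * v) ih₁′ (cong₂ _*_ choose ih₀) ⟩
      (+ 2 * x₂ * q) * ((x₁ * f) * β (2 ℕ.+ m)) + (+ 2 * q) * ((x₂ * x₁) * (f * β (suc m)))
        ≡⟨ factor f (β (suc m)) (β (2 ℕ.+ m)) x₁ x₂ q ⟩
      (x₂ * (x₁ * f)) * (+ 2 * q * β (2 ℕ.+ m) + + 2 * q * β (suc m))
        ≡⟨ cong₂ _*_ factorial (β-recurrence (suc m)) ⟨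
      + ((2 ℕ.+ m) !) * β (3 ℕ.+ m) ∎
      where
      p f t x₁ x₂ : ℤ
      p  = + (2 ^ m)
      f  = + (m !)
      t  = + ((2 ℕ.+ m) C 2)
      x₁ = + suc m
      x₂ = + (2 ℕ.+ m)
      ih₁′ : (+ 2 * p) * a (suc m) ≡ (x₁ * f) * β (2 ℕ.+ m)
      ih₁′ = trans (cong (_* a (suc m)) (sym (ℤₚ.pos-* 2 (2 ^ m))))
                   (trans ih₁ (cong (_* β (2 ℕ.+ m)) (ℤₚ.pos-* (suc m) (m !))))
      choose : + 2 * t ≡ x₂ * x₁
      choose = trans (sym (ℤₚ.pos-* 2 ((2 ℕ.+ m) C 2)))
                     (trans (cong +_ (2*[n+1]C2 (suc m))) (ℤₚ.pos-* (2 ℕ.+ m) (suc m)))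
      factorial : + ((2 ℕ.+ m) !) ≡ x₂ * (x₁ * f)
      factorial = trans (ℤₚ.pos-* (2 ℕ.+ m) (suc m ℕ.* m !)) (cong (x₂ *_) (ℤₚ.pos-* (suc m) (m !)))
      regroup : ∀ p a₀ a₁ x t q → (+ 2 * (+ 2 * p)) * (x * (q * a₁) + t * (q * a₀))
                                 ≡ (+ 2 * x * q) * ((+ 2 * p) * a₁) + (+ 2 * q) * ((+ 2 * t) * (p * a₀))
      regroup = solve-∀
      factor : ∀ f b₁ b₂ x₁ x₂ q → (+ 2 * x₂ * q) * ((x₁ * f) * b₂) + (+ 2 * q) * ((x₂ * x₁) * (f * b₁))
                                   ≡ (x₂ * (x₁ * f)) * (+ 2 * q * b₂ + + 2 * q * b₁)
      factor = solve-∀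

    closed-form : ∀ n → + (2 ^ n) * a n ≡ + (n !) * β (suc n)
    closed-form zero          = trans (cong (+ 1 *_) a₀) (base q)
      where
      base : ∀ q → + 1 * + 1 ≡ + 1 * (q * + 0 + + 1 * + 1)
      base = solve-∀
    closed-form (suc zero)    = trans (cong (+ 2 *_) a₁) (base q)
      where
      base : ∀ q → + 2 * q ≡ + 1 * (q * (q * + 0 + + 1 * + 1) + + 1 * (q * + 1 + q * (q + + 2) * (+ 1 * + 0)))
      base = solve-∀
    closed-form (suc (suc m)) = closed-form-step m (closed-form m) (closed-form (suc m))

luckyGF-closed-form : ∀ q n → + (2 ^ n) * luckyGF q n ≡ + (n !) * ClosedForm.β q (suc n)
luckyGF-closed-form q n = begin
  + (2 ^ n) * luckyGF q n          ≡⟨ cong (+ (2 ^ n) *_) (luckyGF≡weightSum q n) ⟩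
  + (2 ^ n) * weightSum q n n      ≡⟨ closed-form (λ m → weightSum q m m) refl (weightSum-1 q)
                                                   (weightSum-diagonal-recurrence q) n ⟩
  + (n !) * β (suc n)              ∎
  where open ClosedForm q

corollary3p8 : (q : ℤ) (n : ℕ) →
    let open Quad (q * (q + + 2)) in
    ι (+ (2 ^ suc n)) ⊗ (√D ⊗ ι (luckyGF q n))
      ≡ ι (+ (n !)) ⊗ (((ι q ⊕ √D) ⊘ suc n) ⊖ ((ι q ⊖ √D) ⊘ suc n))
corollary3p8 q n = begin
  ι (+ (2 ^ suc n)) ⊗ (√D ⊗ ι (luckyGF q n))
    ≡⟨ ι⊗√D⊗ι (+ (2 ^ suc n)) (luckyGF q n) ⟩
  (+ 0 , + (2 ^ suc n) * luckyGF q n)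
    ≡⟨ cong (+ 0 ,_) doubled ⟩
  (+ 0 , + (n !) * (+ 2 * β (suc n)))
    ≡⟨ ι⊗[u⊖conj-u] (+ (n !)) (α ⊘ suc n) ⟨
  ι (+ (n !)) ⊗ ((α ⊘ suc n) ⊖ conj (α ⊘ suc n))
    ≡⟨ cong₂ (λ u v → ι (+ (n !)) ⊗ ((u ⊘ suc n) ⊖ v))
             ι⊕√D≡α (trans (cong (_⊘ suc n) ι⊖√D≡conj-α) (conj-⊘ α (suc n))) ⟨
  ι (+ (n !)) ⊗ (((ι q ⊕ √D) ⊘ suc n) ⊖ ((ι q ⊖ √D) ⊘ suc n)) ∎
  where
  open Quad (q * (q + + 2))
  open ConjugateInℤ√ (q * (q + + 2))
  open ClosedForm q
  doubled : + (2 ^ suc n) * luckyGF q n ≡ + (n !) * (+ 2 * β (suc n))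
  doubled = begin
    + (2 ^ suc n) * luckyGF q n        ≡⟨ cong (_* luckyGF q n) (ℤₚ.pos-* 2 (2 ^ n)) ⟩
    + 2 * + (2 ^ n) * luckyGF q n      ≡⟨ ℤₚ.*-assoc (+ 2) (+ (2 ^ n)) (luckyGF q n) ⟩
    + 2 * (+ (2 ^ n) * luckyGF q n)    ≡⟨ cong (+ 2 *_) (luckyGF-closed-form q n) ⟩
    + 2 * (+ (n !) * β (suc n))        ≡⟨ x∙yz≈y∙xz (+ 2) (+ (n !)) (β (suc n)) ⟩
    + (n !) * (+ 2 * β (suc n))        ∎
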